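{- Let $a,b$ be integers with $2\leq a\leq b$, and let $K_{a,b}$ denote the complete bipartite graph with parts of sizes $a$ and $b$. Then $\tau_3(K_{a,b})=a-2$.
   Context: For a graph $G$ and $S\subseteq V(G)$ with $|S|\geq 2$, a pendant $S$-Steiner tree is a subgraph of $G$ that is a tree whose vertex set contains $S$ and in which every vertex of $S$ has degree exactly $1$. Two pendant $S$-Steiner trees $T,T'$ are internally disjoint if $E(T)\cap E(T')=\varnothing$ and $V(T)\cap V(T')=S$. $\tau_G(S)$ is the maximum number of pairwise internally disjoint pendant $S$-Steiner trees in $G$, and for $2\leq k\leq |V(G)|$, $\tau_k(G)=\min\{\tau_G(S): S\subseteq V(G),|S|=k\}$. -}

module Defs where

open import Level using (0ℓ)
open import Data.Nat using (ℕ; zero; suc; _+_; _≤_; _<_)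
open import Data.Fin using (Fin; toℕ)
open import Data.Fin.Subset using (Subset; _∈_; ∣_∣)
open import Data.List using (List; []; _∷_; _∷ʳ_; length)
open import Data.List.Relation.Unary.Linked using (Linked)
open import Data.List.Relation.Unary.Unique.Propositional using (Unique)
open import Data.Product using (Σ; ∃; _×_; _,_)
open import Data.Sum using (_⊎_)
open import Data.Empty using (⊥)
open import Relation.Nullary using (¬_)
open import Relation.Binary.PropositionalEquality using (_≡_; _≢_)

record Graph (n : ℕ) : Set₁ where
  field
    Adj   : Fin n → Fin n → Set
    sym   : ∀ {u v} → Adj u v → Adj v u
    irref : ∀ {u} → ¬ Adj u u
open Graph public

record Subgraph {n : ℕ} (G : Graph n) : Set₁ where
  field
    V      : Fin n → Set
    E      : Fin n → Fin n → Set
    E-sym  : ∀ {u v} → E u v → E v u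
    E-adj  : ∀ {u v} → E u v → Adj G u v
    E-V    : ∀ {u v} → E u v → V u × V v
open Subgraph public

data Walk {n : ℕ} (E : Fin n → Fin n → Set) : Fin n → Fin n → Set where
  here : ∀ {u} → Walk E u u
  step : ∀ {u v w} → E u v → Walk E v w → Walk E u w

Cycle : {n : ℕ} → (Fin n → Fin n → Set) → Set
Cycle {n} E = Σ (Fin n) λ x → Σ (List (Fin n)) λ ys →
  (2 ≤ length ys) × Unique (x ∷ ys) × Linked E ((x ∷ ys) ∷ʳ x)

IsTree : {n : ℕ} {G : Graph n} → Subgraph G → Set
IsTree T = (∀ u v → V T u → V T v → Walk (E T) u v) × ¬ Cycle (E T)

Degree1 : {n : ℕ} {G : Graph n} → Subgraph G → Fin n → Set
Degree1 {n} T v = Σ (Fin n) λ u → E T v u × (∀ w → E T v w → w ≡ u)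

IsPendantSteinerTree : {n : ℕ} (G : Graph n) → Subset n → Subgraph G → Set
IsPendantSteinerTree G S T =
  IsTree T × (∀ v → v ∈ S → V T v) × (∀ v → v ∈ S → Degree1 T v)

InternallyDisjoint : {n : ℕ} {G : Graph n} → Subset n → Subgraph G → Subgraph G → Set
InternallyDisjoint S T T′ =
  (∀ u v → ¬ (E T u v × E T′ u v)) ×
  (∀ v → (V T v × V T′ v → v ∈ S) × (v ∈ S → V T v × V T′ v))

HasDisjointTrees : {n : ℕ} (G : Graph n) → Subset n → ℕ → Set₁
HasDisjointTrees G S m =
  Σ (Fin m → Subgraph G) λ T →
    (∀ i → IsPendantSteinerTree G S (T i)) ×
    (∀ i j → i ≢ j → InternallyDisjoint S (T i) (T j))

IsTau : {n : ℕ} (G : Graph n) → Subset n → ℕ → Set₁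
IsTau G S t = HasDisjointTrees G S t × (∀ m → HasDisjointTrees G S m → m ≤ t)

IsTauK : {n : ℕ} → ℕ → Graph n → ℕ → Set₁
IsTauK {n} k G t =
  (∀ S → ∣ S ∣ ≡ k → Σ ℕ λ s → IsTau G S s × t ≤ s) ×
  (Σ (Subset n) λ S → ∣ S ∣ ≡ k × IsTau G S t)

KAdj : (a b : ℕ) → Fin (a + b) → Fin (a + b) → Set
KAdj a b u v = (toℕ u < a × a ≤ toℕ v) ⊎ (toℕ v < a × a ≤ toℕ u)

K : (a b : ℕ) → Graph (a + b)
K a b = record { Adj = KAdj a b ; sym = sym′ ; irref = irref′ }
  where
  open import Data.Sum using (inj₁; inj₂)
  open import Data.Nat.Properties using (<-≤-trans; <-irrefl)
  open import Relation.Binary.PropositionalEquality using (refl)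
  sym′ : ∀ {u v} → KAdj a b u v → KAdj a b v u
  sym′ (inj₁ p) = inj₂ p
  sym′ (inj₂ p) = inj₁ p
  irref′ : ∀ {u} → ¬ KAdj a b u u
  irref′ (inj₁ (p , q)) = <-irrefl refl (<-≤-trans p q)
  irref′ (inj₂ (p , q)) = <-irrefl refl (<-≤-trans p q)

-- A family of internally disjoint pendant S-Steiner trees gives every terminal x pairwise
-- distinct neighbours outside S: a neighbour in S would make two adjacent leaves a whole
-- component of the tree. In K_{a,b} this bounds τ(S) by b when S lies in the part of size a,
-- and by min(a − 2, b − 1) when two terminals lie in that part and one in the other. Spiders
-- attain these bounds: stars centred in the other part, respectively one terminal joined to
-- a centre p, the other two to a centre q, and p to q. Hence τ₃ = a − 2 for a ≤ b, attained
-- by two terminals in the smaller part.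

module Submission where

open import Defs hiding (sym)
open import Data.Nat using (ℕ; suc; z≤n; _+_; _∸_; _≤_; _<_; _⊓_; s≤s)
open import Data.Nat.Properties using (<⇒≱; ≤-trans; m≤m+n; m≤n⇒m⊓n≡m; m≤n+m; m≤n⇒m≤1+n; ⊓-glb; ⊓-monoʳ-≤; m⊓n≤m; m⊓n≤n; n≤1+n)
open import Data.Fin using (Fin; zero; suc; toℕ; punchIn; punchOut; inject≤; _↑ˡ_; _↑ʳ_; splitAt; _≟_)
open import Data.Fin.Properties using (suc-injective; toℕ<n; toℕ-↑ˡ; toℕ-↑ʳ; ↑ˡ-injective; ↑ʳ-injective; join-splitAt; punchIn-injective; punchInᵢ≢i; punchOut-injective; punchIn-punchOut; inject≤-injective; injective⇒≤)
open import Data.Vec using ([]; _∷_; here; there)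
open import Data.Fin.Subset using (Subset; _∈_; _∉_; ∣_∣; inside; outside; ⁅_⁆)
open import Data.Fin.Subset.Properties using (∣⁅x⁆∣≡1; x∈⁅x⁆; x∈⁅y⁆⇒x≡y)
open import Data.List using (List; []; _∷_; _++_; length; map)
open import Data.List.Properties using (length-map)
open import Data.List.Membership.Propositional using () renaming (_∈_ to _∈ˡ_)
open import Data.List.Membership.Propositional.Properties using (∈-map⁺; ∈-map⁻)
open import Data.List.Relation.Unary.Any using (here; there)
open import Data.List.Relation.Unary.All as All using (All; []; _∷_)
open import Data.List.Relation.Unary.AllPairs using ([]; _∷_)
open import Data.List.Relation.Unary.Linked using (Linked; [-]; _∷_)
open import Data.List.Relation.Unary.Unique.Propositional using (Unique)
import Data.List.Relation.Unary.Unique.Propositional.Properties as Unique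
open import Data.Product using (Σ; ∃-syntax; _×_; _,_; proj₁; proj₂)
open import Data.Sum using (_⊎_; inj₁; inj₂; [_,_]′)
open import Data.Empty using (⊥; ⊥-elim)
open import Function using (id)
open import Function.Definitions using (Injective)
open import Relation.Nullary using (¬_)
open import Relation.Nullary.Decidable using (decidable-stable)
open import Relation.Binary.PropositionalEquality using (_≡_; _≢_; refl; sym; trans; cong; subst)

module _ {n : ℕ} {R : Fin n → Fin n → Set} where

  _++ʷ_ : ∀ {u v w} → Walk R u v → Walk R v w → Walk R u w
  here     ++ʷ q = q
  step e p ++ʷ q = step e (p ++ʷ q)

  reverseʷ : (∀ {u v} → R u v → R v u) → ∀ {u v} → Walk R u v → Walk R v u
  reverseʷ R-sym here       = here
  reverseʷ R-sym (step e p) = reverseʷ R-sym p ++ʷ step (R-sym e) here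

record Triple {n : ℕ} (S : Subset n) (x y z : Fin n) : Set where
  field
    x≢y : x ≢ y
    x≢z : x ≢ z
    y≢z : y ≢ z
    x∈S : x ∈ S
    y∈S : y ∈ S
    z∈S : z ∈ S
    ∈S⇒ : ∀ {v} → v ∈ S → v ≡ x ⊎ v ≡ y ⊎ v ≡ z

  ∉S : ∀ {v} → v ≢ x → v ≢ y → v ≢ z → v ∉ S
  ∉S v≢x v≢y v≢z v∈S = [ v≢x , [ v≢y , v≢z ]′ ]′ (∈S⇒ v∈S)

module _ {n : ℕ} {S : Subset n} {x y z : Fin n} (t : Triple S x y z) where
  open Triple t

  Triple-swap₁₂ : Triple S y x z
  Triple-swap₁₂ = record
    { x≢y = λ eq → x≢y (sym eq) ; x≢z = y≢z ; y≢z = x≢z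
    ; x∈S = y∈S ; y∈S = x∈S ; z∈S = z∈S
    ; ∈S⇒ = λ v∈S → [ (λ v≡x → inj₂ (inj₁ v≡x)) , [ inj₁ , (λ v≡z → inj₂ (inj₂ v≡z)) ]′ ]′ (∈S⇒ v∈S) }

  Triple-rotate : Triple S z x y
  Triple-rotate = record
    { x≢y = λ eq → x≢z (sym eq) ; x≢z = λ eq → y≢z (sym eq) ; y≢z = x≢y
    ; x∈S = z∈S ; y∈S = x∈S ; z∈S = y∈S
    ; ∈S⇒ = λ v∈S → [ (λ v≡x → inj₂ (inj₁ v≡x)) , [ (λ v≡y → inj₂ (inj₂ v≡y)) , inj₁ ]′ ]′ (∈S⇒ v∈S) }

elements : ∀ {n} → Subset n → List (Fin n)
elements []            = []
elements (inside ∷ p)  = zero ∷ map suc (elements p)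
elements (outside ∷ p) = map suc (elements p)

length-elements : ∀ {n} (p : Subset n) → length (elements p) ≡ ∣ p ∣
length-elements []            = refl
length-elements (inside ∷ p)  = cong suc (trans (length-map suc (elements p)) (length-elements p))
length-elements (outside ∷ p) = trans (length-map suc (elements p)) (length-elements p)

∈-elements⁺ : ∀ {n} {p : Subset n} {v} → v ∈ p → v ∈ˡ elements p
∈-elements⁺ {p = inside ∷ p}  here         = here refl
∈-elements⁺ {p = inside ∷ p}  (there v∈p) = there (∈-map⁺ suc (∈-elements⁺ v∈p))
∈-elements⁺ {p = outside ∷ p} (there v∈p) = ∈-map⁺ suc (∈-elements⁺ v∈p)

∈-elements⁻ : ∀ {n} {p : Subset n} {v} → v ∈ˡ elements p → v ∈ p
∈-elements⁻ {p = inside ∷ p} (here refl) = here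
∈-elements⁻ {p = inside ∷ p} (there v∈) with ∈-map⁻ suc v∈
... | _ , w∈ , refl = there (∈-elements⁻ w∈)
∈-elements⁻ {p = outside ∷ p} v∈ with ∈-map⁻ suc v∈
... | _ , w∈ , refl = there (∈-elements⁻ w∈)

elements-unique : ∀ {n} (p : Subset n) → Unique (elements p)
elements-unique []            = []
elements-unique (inside ∷ p)  = All.tabulate zero∉ ∷ Unique.map⁺ suc-injective (elements-unique p)
  where
  zero∉ : ∀ {v} → v ∈ˡ map suc (elements p) → zero ≢ v
  zero∉ v∈ refl with ∈-map⁻ suc v∈
  ... | _ , _ , ()
elements-unique (outside ∷ p) = Unique.map⁺ suc-injective (elements-unique p)

triple-of-∣S∣≡3 : ∀ {n} {S : Subset n} → ∣ S ∣ ≡ 3 → ∃[ x ] ∃[ y ] ∃[ z ] Triple S x y z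
triple-of-∣S∣≡3 {S = S} ∣S∣≡3 = go (elements S) (trans (length-elements S) ∣S∣≡3) (elements-unique S) ∈-elements⁻ ∈-elements⁺
  where
  go : ∀ vs → length vs ≡ 3 → Unique vs → (∀ {v} → v ∈ˡ vs → v ∈ S) → (∀ {v} → v ∈ S → v ∈ˡ vs) →
       ∃[ x ] ∃[ y ] ∃[ z ] Triple S x y z
  go (x ∷ y ∷ z ∷ []) _ ((x≢y ∷ x≢z ∷ []) ∷ (y≢z ∷ []) ∷ [] ∷ []) sound complete = x , y , z , record
    { x≢y = x≢y ; x≢z = x≢z ; y≢z = y≢z
    ; x∈S = sound (here refl) ; y∈S = sound (there (here refl)) ; z∈S = sound (there (there (here refl)))
    ; ∈S⇒ = λ v∈S → which (complete v∈S) }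
    where
    which : ∀ {v} → v ∈ˡ x ∷ y ∷ z ∷ [] → v ≡ x ⊎ v ≡ y ⊎ v ≡ z
    which (here v≡x)                = inj₁ v≡x
    which (there (here v≡y))        = inj₂ (inj₁ v≡y)
    which (there (there (here v≡z))) = inj₂ (inj₂ v≡z)

pair-pigeonhole : ∀ {n} {u v w c₁ c₂ : Fin n} → u ≢ v → u ≢ w → v ≢ w →
  u ≡ c₁ ⊎ u ≡ c₂ → v ≡ c₁ ⊎ v ≡ c₂ → w ≡ c₁ ⊎ w ≡ c₂ → ⊥
pair-pigeonhole u≢v _   _   (inj₁ p) (inj₁ q) _        = u≢v (trans p (sym q))
pair-pigeonhole u≢v _   _   (inj₂ p) (inj₂ q) _        = u≢v (trans p (sym q))
pair-pigeonhole _   u≢w _   (inj₁ p) (inj₂ _) (inj₁ r) = u≢w (trans p (sym r))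
pair-pigeonhole _   _   v≢w (inj₁ _) (inj₂ q) (inj₂ r) = v≢w (trans q (sym r))
pair-pigeonhole _   _   v≢w (inj₂ _) (inj₁ q) (inj₁ r) = v≢w (trans q (sym r))
pair-pigeonhole _   u≢w _   (inj₂ p) (inj₁ _) (inj₂ r) = u≢w (trans p (sym r))

module _ {n : ℕ} {E : Fin n → Fin n → Set} (E-sym : ∀ {u v} → E u v → E v u) where

  private
    last-edge : ∀ {c} w rs → Linked E (w ∷ rs ++ c ∷ []) → ∃[ ℓ ] E ℓ c × ℓ ∈ˡ w ∷ rs
    last-edge w []       (e ∷ [-]) = w , e , here refl
    last-edge w (r ∷ rs) (_ ∷ L) with last-edge r rs L
    ... | ℓ , e , ℓ∈ = ℓ , e , there ℓ∈

  -- The first three vertices of a cycle are distinct and each has two distinct cycle neighbours.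
  ≤2-branch-vertices⇒¬Cycle : ∀ {c₁ c₂} →
    (∀ {w u₁ u₂} → E w u₁ → E w u₂ → u₁ ≢ u₂ → w ≡ c₁ ⊎ w ≡ c₂) → ¬ Cycle E
  ≤2-branch-vertices⇒¬Cycle _ (_ , [] , () , _)
  ≤2-branch-vertices⇒¬Cycle _ (_ , _ ∷ [] , s≤s () , _)
  ≤2-branch-vertices⇒¬Cycle {c₁} {c₂} branch
    (x , y₁ ∷ y₂ ∷ rest , _ , (x≢y₁ ∷ x≢y₂ ∷ _) ∷ (y₁≢y₂ ∷ y₁≢rest) ∷ _ , e₁ ∷ e₂ ∷ L) =
    pair-pigeonhole x≢y₁ x≢y₂ y₁≢y₂ x-branches (branch (E-sym e₁) e₂ x≢y₂) (y₂-branches rest L y₁≢rest)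
    where
    x-branches : x ≡ c₁ ⊎ x ≡ c₂
    x-branches with last-edge y₂ rest L
    ... | ℓ , e , ℓ∈ = branch e₁ (E-sym e) (All.lookup (y₁≢y₂ ∷ y₁≢rest) ℓ∈)
    y₂-branches : ∀ rs → Linked E (y₂ ∷ rs ++ x ∷ []) → All (y₁ ≢_) rs → y₂ ≡ c₁ ⊎ y₂ ≡ c₂
    y₂-branches []      (e₃ ∷ [-]) []         = branch (E-sym e₂) e₃ (λ eq → x≢y₁ (sym eq))
    y₂-branches (_ ∷ _) (e₃ ∷ _)   (y₁≢r ∷ _) = branch (E-sym e₂) e₃ y₁≢r

Degree1-unique : ∀ {n} {G : Graph n} (T : Subgraph G) {v u w} → Degree1 T v → E T v u → E T v w → u ≡ w
Degree1-unique _ (_ , _ , unique) e e′ = trans (unique _ e) (sym (unique _ e′))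

module _ {n : ℕ} {G : Graph n} {S : Subset n} (T : Subgraph G) (pendant : IsPendantSteinerTree G S T) where

  private
    connected : ∀ u v → V T u → V T v → Walk (E T) u v
    connected = proj₁ (proj₁ pendant)
    ∈S⇒∈T : ∀ v → v ∈ S → V T v
    ∈S⇒∈T = proj₁ (proj₂ pendant)
    ∈S⇒leaf : ∀ v → v ∈ S → Degree1 T v
    ∈S⇒leaf = proj₂ (proj₂ pendant)

  -- Adjacent leaves x, y form a whole component of the tree, which then misses z.
  pendant-terminals-nonadjacent : ∀ {x y z} → x ∈ S → y ∈ S → z ∈ S → z ≢ x → z ≢ y → ¬ E T x y
  pendant-terminals-nonadjacent {x} {y} {z} x∈S y∈S z∈S z≢x z≢y x∼y =
    [ z≢x , z≢y ]′ (stays (connected x z (∈S⇒∈T x x∈S) (∈S⇒∈T z z∈S)) (inj₁ refl))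
    where
    stays : ∀ {u w} → Walk (E T) u w → u ≡ x ⊎ u ≡ y → w ≡ x ⊎ w ≡ y
    stays here         u∈xy        = u∈xy
    stays (step e walk) (inj₁ refl) = stays walk (inj₂ (Degree1-unique T (∈S⇒leaf x x∈S) e x∼y))
    stays (step e walk) (inj₂ refl) = stays walk (inj₁ (Degree1-unique T (∈S⇒leaf y y∈S) e (E-sym T x∼y)))

  pendant-neighbour-∉S : ∀ {x y z u} → Triple S x y z → E T x u → u ∉ S
  pendant-neighbour-∉S {x} {y} {z} t x∼u u∈S with Triple.∈S⇒ t u∈S
  ... | inj₁ refl        = irref G (E-adj T x∼u)
  ... | inj₂ (inj₁ refl) = pendant-terminals-nonadjacent x∈S y∈S z∈S (λ eq → x≢z (sym eq)) (λ eq → y≢z (sym eq)) x∼u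
    where open Triple t
  ... | inj₂ (inj₂ refl) = pendant-terminals-nonadjacent x∈S z∈S y∈S (λ eq → x≢y (sym eq)) y≢z x∼u
    where open Triple t

terminal-neighbours : ∀ {n m} {G : Graph n} {S : Subset n} {x y z} → Triple S x y z → HasDisjointTrees G S m →
  Σ (Fin m → Fin n) λ f → Injective _≡_ _≡_ f × (∀ i → Adj G x (f i) × f i ∉ S)
terminal-neighbours {n} {m} {x = x} t (T , pendant , disjoint) =
  f , f-injective , λ i → E-adj (T i) (x∼f i) , pendant-neighbour-∉S (T i) (pendant i) t (x∼f i)
  where
  leaf : ∀ i → Degree1 (T i) x
  leaf i = proj₂ (proj₂ (pendant i)) x (Triple.x∈S t)
  f : Fin m → Fin n
  f i = proj₁ (leaf i)
  x∼f : ∀ i → E (T i) x (f i)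
  x∼f i = proj₁ (proj₂ (leaf i))
  f∈T : ∀ i → V (T i) (f i)
  f∈T i = proj₂ (E-V (T i) (x∼f i))
  f-injective : Injective _≡_ _≡_ f
  f-injective {i} {j} fi≡fj = decidable-stable (i ≟ j) λ i≢j →
    pendant-neighbour-∉S (T i) (pendant i) t (x∼f i)
      (proj₁ (proj₂ (disjoint i j i≢j) (f i)) (f∈T i , subst (V (T j)) (sym fi≡fj) (f∈T j)))

-- The i-th spider joins x to p i, both y and z to q i, and p i to q i when they are adjacent;
-- when p i ≡ q i it is the star at p i.
module Spiders {n : ℕ} {G : Graph n} {S : Subset n} {x y z : Fin n} (t : Triple S x y z)
  {m : ℕ} (p q : Fin m → Fin n)
  (x∼p : ∀ i → Adj G x (p i)) (y∼q : ∀ i → Adj G y (q i)) (z∼q : ∀ i → Adj G z (q i))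
  (p≡q⊎p∼q : ∀ i → p i ≡ q i ⊎ Adj G (p i) (q i))
  (p∉S : ∀ i → p i ∉ S) (q∉S : ∀ i → q i ∉ S)
  (centres-disjoint : ∀ {i j w} → w ≡ p i ⊎ w ≡ q i → w ≡ p j ⊎ w ≡ q j → i ≡ j)
  where

  open Triple t

  Centre : Fin m → Fin n → Set
  Centre i w = w ≡ p i ⊎ w ≡ q i

  Leg : Fin m → Fin n → Fin n → Set
  Leg i s c = (s ≡ x × c ≡ p i) ⊎ (s ≡ y × c ≡ q i) ⊎ (s ≡ z × c ≡ q i)

  Arc : Fin m → Fin n → Fin n → Set
  Arc i u v = Leg i u v ⊎ (u ≡ p i × v ≡ q i × Adj G (p i) (q i))

  Edge : Fin m → Fin n → Fin n → Set
  Edge i u v = Arc i u v ⊎ Arc i v u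

  Vertex : Fin m → Fin n → Set
  Vertex i v = v ∈ S ⊎ Centre i v

  module _ {i : Fin m} where

    centre∉S : ∀ {w} → Centre i w → w ∉ S
    centre∉S (inj₁ refl) = p∉S i
    centre∉S (inj₂ refl) = q∉S i

    leg-∈S : ∀ {s c} → Leg i s c → s ∈ S
    leg-∈S (inj₁ (refl , _))        = x∈S
    leg-∈S (inj₂ (inj₁ (refl , _))) = y∈S
    leg-∈S (inj₂ (inj₂ (refl , _))) = z∈S

    leg-centre : ∀ {s c} → Leg i s c → Centre i c
    leg-centre (inj₁ (_ , c≡p))        = inj₁ c≡p
    leg-centre (inj₂ (inj₁ (_ , c≡q))) = inj₂ c≡q
    leg-centre (inj₂ (inj₂ (_ , c≡q))) = inj₂ c≡q

    leg-adj : ∀ {s c} → Leg i s c → Adj G s c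
    leg-adj (inj₁ (refl , refl))        = x∼p i
    leg-adj (inj₂ (inj₁ (refl , refl))) = y∼q i
    leg-adj (inj₂ (inj₂ (refl , refl))) = z∼q i

    leg-from : ∀ {s} → s ∈ S → ∃[ c ] Leg i s c
    leg-from s∈S with ∈S⇒ s∈S
    ... | inj₁ s≡x        = p i , inj₁ (s≡x , refl)
    ... | inj₂ (inj₁ s≡y) = q i , inj₂ (inj₁ (s≡y , refl))
    ... | inj₂ (inj₂ s≡z) = q i , inj₂ (inj₂ (s≡z , refl))

    x-leg-only : ∀ {s c} → s ≡ x → (s ≡ y × c ≡ q i) ⊎ (s ≡ z × c ≡ q i) → ⊥
    x-leg-only s≡x = [ (λ (s≡y , _) → x≢y (trans (sym s≡x) s≡y)) , (λ (s≡z , _) → x≢z (trans (sym s≡x) s≡z)) ]′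

    leg-functional : ∀ {s c c′} → Leg i s c → Leg i s c′ → c ≡ c′
    leg-functional (inj₁ (_ , c≡p))  (inj₁ (_ , c′≡p)) = trans c≡p (sym c′≡p)
    leg-functional (inj₂ l)          (inj₂ l′)         = trans ([ proj₂ , proj₂ ]′ l) (sym ([ proj₂ , proj₂ ]′ l′))
    leg-functional (inj₁ (s≡x , _))  (inj₂ l′)         = ⊥-elim (x-leg-only s≡x l′)
    leg-functional (inj₂ l)          (inj₁ (s≡x , _))  = ⊥-elim (x-leg-only s≡x l)

    arc-target-centre : ∀ {u v} → Arc i u v → Centre i v
    arc-target-centre (inj₁ l)              = leg-centre l
    arc-target-centre (inj₂ (_ , v≡q , _)) = inj₂ v≡q

    arc-source-vertex : ∀ {u v} → Arc i u v → Vertex i u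
    arc-source-vertex (inj₁ l)              = inj₁ (leg-∈S l)
    arc-source-vertex (inj₂ (u≡p , _ , _)) = inj₂ (inj₁ u≡p)

    arc-adj : ∀ {u v} → Arc i u v → Adj G u v
    arc-adj (inj₁ l)                  = leg-adj l
    arc-adj (inj₂ (refl , refl , p∼q)) = p∼q

    edge-sym : ∀ {u v} → Edge i u v → Edge i v u
    edge-sym = [ inj₂ , inj₁ ]′

    edge-endpoints : ∀ {u v} → Edge i u v → Vertex i u × Vertex i v
    edge-endpoints (inj₁ a) = arc-source-vertex a , inj₂ (arc-target-centre a)
    edge-endpoints (inj₂ a) = inj₂ (arc-target-centre a) , arc-source-vertex a

    terminal-edge : ∀ {s v} → s ∈ S → Edge i s v → Leg i s v
    terminal-edge s∈S (inj₁ (inj₁ l))            = l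
    terminal-edge s∈S (inj₁ (inj₂ (s≡p , _ , _))) = ⊥-elim (p∉S i (subst (_∈ S) s≡p s∈S))
    terminal-edge s∈S (inj₂ a)                    = ⊥-elim (centre∉S (arc-target-centre a) s∈S)

    centre-to-q : ∀ {c} → Centre i c → Walk (Edge i) c (q i)
    centre-to-q (inj₂ refl) = here
    centre-to-q (inj₁ refl) with p≡q⊎p∼q i
    ... | inj₁ p≡q = subst (Walk (Edge i) (p i)) p≡q here
    ... | inj₂ p∼q = step (inj₁ (inj₂ (refl , refl , p∼q))) here

    to-q : ∀ {v} → Vertex i v → Walk (Edge i) v (q i)
    to-q (inj₁ v∈S) with leg-from v∈S
    ... | _ , l = step (inj₁ (inj₁ l)) (centre-to-q (leg-centre l))
    to-q (inj₂ c) = centre-to-q c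

    branch-centre : ∀ {w u₁ u₂} → Edge i w u₁ → Edge i w u₂ → u₁ ≢ u₂ → Centre i w
    branch-centre e₁ e₂ u₁≢u₂ with proj₁ (edge-endpoints e₁)
    ... | inj₁ w∈S = ⊥-elim (u₁≢u₂ (leg-functional (terminal-edge w∈S e₁) (terminal-edge w∈S e₂)))
    ... | inj₂ c   = c

  Tree : Fin m → Subgraph G
  Tree i = record
    { V = Vertex i ; E = Edge i ; E-sym = edge-sym
    ; E-adj = [ arc-adj , (λ a → Graph.sym G (arc-adj a)) ]′ ; E-V = edge-endpoints }

  Tree-pendant : ∀ i → IsPendantSteinerTree G S (Tree i)
  Tree-pendant i = (connected , ≤2-branch-vertices⇒¬Cycle edge-sym branch-centre) , (λ _ → inj₁) , λ _ → leaf
    where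
    connected : ∀ u v → Vertex i u → Vertex i v → Walk (Edge i) u v
    connected _ _ u∈ v∈ = to-q u∈ ++ʷ reverseʷ edge-sym (to-q v∈)
    leaf : ∀ {s} → s ∈ S → Degree1 (Tree i) s
    leaf s∈S with leg-from s∈S
    ... | c , l = c , inj₁ (inj₁ l) , λ _ e → leg-functional (terminal-edge s∈S e) l

  centre-shared : ∀ {i j w} → Centre i w → Vertex j w → i ≡ j
  centre-shared c (inj₁ w∈S) = ⊥-elim (centre∉S c w∈S)
  centre-shared c (inj₂ c′)  = centres-disjoint c c′

  Trees-disjoint : ∀ i j → i ≢ j → InternallyDisjoint S (Tree i) (Tree j)
  Trees-disjoint i j i≢j = no-common-edge , λ v → common-vertex v , λ v∈S → inj₁ v∈S , inj₁ v∈S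
    where
    no-common-edge : ∀ u v → ¬ (Edge i u v × Edge j u v)
    no-common-edge _ _ (inj₁ a , e) = i≢j (centre-shared (arc-target-centre a) (proj₂ (edge-endpoints e)))
    no-common-edge _ _ (inj₂ a , e) = i≢j (centre-shared (arc-target-centre a) (proj₁ (edge-endpoints e)))
    common-vertex : ∀ v → Vertex i v × Vertex j v → v ∈ S
    common-vertex _ (inj₁ v∈S , _) = v∈S
    common-vertex _ (inj₂ c , v∈) = ⊥-elim (i≢j (centre-shared c v∈))

  family : HasDisjointTrees G S m
  family = Tree , Tree-pendant , Trees-disjoint

injective-avoiding⇒≤ : ∀ {m n} {f : Fin m → Fin (suc n)} {k} →
  Injective _≡_ _≡_ f → (∀ i → f i ≢ k) → m ≤ n
injective-avoiding⇒≤ {f = f} {k} f-inj f≢k =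
  injective⇒≤ λ {i} {j} eq → f-inj (punchOut-injective (k≢f i) (k≢f j) eq)
  where
  k≢f : ∀ i → k ≢ f i
  k≢f i eq = f≢k i (sym eq)

injective-avoiding₂⇒≤ : ∀ {m n} {f : Fin m → Fin (suc (suc n))} {k l} →
  Injective _≡_ _≡_ f → k ≢ l → (∀ i → f i ≢ k) → (∀ i → f i ≢ l) → m ≤ n
injective-avoiding₂⇒≤ {f = f} {k} f-inj k≢l f≢k f≢l =
  injective-avoiding⇒≤ {f = λ i → punchOut (k≢f i)} {punchOut k≢l}
    (λ {i} {j} eq → f-inj (punchOut-injective (k≢f i) (k≢f j) eq))
    (λ i eq → f≢l i (punchOut-injective (k≢f i) k≢l eq))
  where
  k≢f : ∀ i → k ≢ f i
  k≢f i eq = f≢k i (sym eq)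

module _ {n : ℕ} {k l : Fin (suc (suc n))} (k≢l : k ≢ l) where

  punchIn₂ : Fin n → Fin (suc (suc n))
  punchIn₂ i = punchIn k (punchIn (punchOut k≢l) i)

  punchIn₂-injective : Injective _≡_ _≡_ punchIn₂
  punchIn₂-injective eq = punchIn-injective _ _ _ (punchIn-injective k _ _ eq)

  punchIn₂≢₁ : ∀ i → punchIn₂ i ≢ k
  punchIn₂≢₁ i = punchInᵢ≢i k _

  punchIn₂≢₂ : ∀ i → punchIn₂ i ≢ l
  punchIn₂≢₂ i eq = punchInᵢ≢i (punchOut k≢l) i
    (punchIn-injective k _ _ (trans eq (sym (punchIn-punchOut k≢l))))

record CompleteBipartite {n : ℕ} (G : Graph n) (a b : ℕ) : Set where
  field
    left            : Fin a → Fin n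
    right           : Fin b → Fin n
    left-injective  : Injective _≡_ _≡_ left
    right-injective : Injective _≡_ _≡_ right
    side            : ∀ v → (∃[ i ] left i ≡ v) ⊎ (∃[ j ] right j ≡ v)
    left∼right      : ∀ i j → Adj G (left i) (right j)
    left≁left       : ∀ i i′ → ¬ Adj G (left i) (left i′)
    right≁right     : ∀ j j′ → ¬ Adj G (right j) (right j′)

  left≢right : ∀ i j → left i ≢ right j
  left≢right i j eq = right≁right j j (subst (λ v → Adj G v (right j)) eq (left∼right i j))

  left-neighbour : ∀ {i v} → Adj G (left i) v → ∃[ j ] right j ≡ v
  left-neighbour {i} {v} i∼v with side v
  ... | inj₁ (i′ , refl) = ⊥-elim (left≁left i i′ i∼v)
  ... | inj₂ j           = j

swap : ∀ {n} {G : Graph n} {a b} → CompleteBipartite G a b → CompleteBipartite G b a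
swap {G = G} KB = record
  { left = right ; right = left ; left-injective = right-injective ; right-injective = left-injective
  ; side = λ v → [ inj₂ , inj₁ ]′ (side v)
  ; left∼right = λ j i → Graph.sym G (left∼right i j)
  ; left≁left = right≁right ; right≁right = left≁left }
  where open CompleteBipartite KB

K-complete-bipartite : ∀ a b → CompleteBipartite (K a b) a b
K-complete-bipartite a b = record
  { left = _↑ˡ b ; right = a ↑ʳ_
  ; left-injective = ↑ˡ-injective b _ _ ; right-injective = ↑ʳ-injective a _ _
  ; side = side
  ; left∼right = λ i j → inj₁ (left<a i , a≤right j)
  ; left≁left = λ { i i′ (inj₁ (_ , a≤i′)) → <⇒≱ (left<a i′) a≤i′ ; i i′ (inj₂ (_ , a≤i)) → <⇒≱ (left<a i) a≤i }
  ; right≁right = λ { j j′ (inj₁ (j<a , _)) → <⇒≱ j<a (a≤right j) ; j j′ (inj₂ (j′<a , _)) → <⇒≱ j′<a (a≤right j′) } }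
  where
  left<a : ∀ i → toℕ (i ↑ˡ b) < a
  left<a i = subst (_< a) (sym (toℕ-↑ˡ i b)) (toℕ<n i)
  a≤right : ∀ j → a ≤ toℕ (a ↑ʳ j)
  a≤right j = subst (a ≤_) (sym (toℕ-↑ʳ a j)) (m≤m+n a (toℕ j))
  side : ∀ v → (∃[ i ] i ↑ˡ b ≡ v) ⊎ (∃[ j ] a ↑ʳ j ≡ v)
  side v with splitAt a v | join-splitAt a b v
  ... | inj₁ i | eq = inj₁ (i , eq)
  ... | inj₂ j | eq = inj₂ (j , eq)

∉⇒≢ : ∀ {n} {S : Subset n} {u v} → u ∉ S → v ∈ S → u ≢ v
∉⇒≢ u∉S v∈S refl = u∉S v∈S

module _ {n : ℕ} {G : Graph n} {a b : ℕ} (KB : CompleteBipartite G a b) where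

  open CompleteBipartite KB

  left-terminal-neighbours : ∀ {S i y z m} → Triple S (left i) y z → HasDisjointTrees G S m →
    Σ (Fin m → Fin b) λ g → Injective _≡_ _≡_ g × (∀ k → right (g k) ∉ S)
  left-terminal-neighbours {S} {m = m} t H with terminal-neighbours t H
  ... | f , f-injective , f-ok = g , g-injective , λ k → subst (_∉ S) (sym (right-g k)) (proj₂ (f-ok k))
    where
    g : Fin m → Fin b
    g k = proj₁ (left-neighbour (proj₁ (f-ok k)))
    right-g : ∀ k → right (g k) ≡ f k
    right-g k = proj₂ (left-neighbour (proj₁ (f-ok k)))
    g-injective : Injective _≡_ _≡_ g
    g-injective {k} {k′} eq = f-injective (trans (sym (right-g k)) (trans (cong right eq) (right-g k′)))

  τ-same-side : ∀ {S i₁ i₂ i₃} → Triple S (left i₁) (left i₂) (left i₃) → IsTau G S b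
  τ-same-side {S} {i₁} {i₂} {i₃} t =
    Spiders.family t right right (λ j → left∼right i₁ j) (λ j → left∼right i₂ j) (λ j → left∼right i₃ j)
      (λ _ → inj₁ refl) right∉S right∉S centres-disjoint ,
    λ m H → injective⇒≤ (proj₁ (proj₂ (left-terminal-neighbours t H)))
    where
    right∉S : ∀ j → right j ∉ S
    right∉S j = Triple.∉S t (λ eq → left≢right i₁ j (sym eq)) (λ eq → left≢right i₂ j (sym eq)) (λ eq → left≢right i₃ j (sym eq))
    centres-disjoint : ∀ {j j′ w} → w ≡ right j ⊎ w ≡ right j → w ≡ right j′ ⊎ w ≡ right j′ → j ≡ j′
    centres-disjoint w≡ w≡′ = right-injective (trans (sym ([ id , id ]′ w≡)) ([ id , id ]′ w≡′))

τ-two-sides : ∀ {n} {G : Graph n} {a b} (KB : CompleteBipartite G (suc (suc a)) (suc b)) →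
  let open CompleteBipartite KB in
  ∀ {S j i i′} → Triple S (right j) (left i) (left i′) → IsTau G S (a ⊓ b)
τ-two-sides {n} {G} {a} {b} KB {S} {j} {i} {i′} t = Spiders.family t p q
    (λ _ → Graph.sym G (left∼right _ j)) (λ _ → left∼right i _) (λ _ → left∼right i′ _)
    (λ _ → inj₂ (left∼right _ _)) p∉S q∉S centres-disjoint ,
  λ m H → ⊓-glb (bound-left m H) (bound-right m H)
  where
  open CompleteBipartite KB
  open Triple t
  i≢i′ : i ≢ i′
  i≢i′ eq = y≢z (cong left eq)
  p : Fin (a ⊓ b) → Fin n
  p k = left (punchIn₂ i≢i′ (inject≤ k (m⊓n≤m a b)))
  q : Fin (a ⊓ b) → Fin n
  q k = right (punchIn j (inject≤ k (m⊓n≤n a b)))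
  p∉S : ∀ k → p k ∉ S
  p∉S k = ∉S (left≢right _ j)
    (λ eq → punchIn₂≢₁ i≢i′ _ (left-injective eq)) (λ eq → punchIn₂≢₂ i≢i′ _ (left-injective eq))
  q∉S : ∀ k → q k ∉ S
  q∉S k = ∉S (λ eq → punchInᵢ≢i j _ (right-injective eq))
    (λ eq → left≢right i _ (sym eq)) (λ eq → left≢right i′ _ (sym eq))
  centres-disjoint : ∀ {k k′ w} → w ≡ p k ⊎ w ≡ q k → w ≡ p k′ ⊎ w ≡ q k′ → k ≡ k′
  centres-disjoint (inj₁ refl) (inj₁ eq) =
    inject≤-injective _ _ _ _ (punchIn₂-injective i≢i′ (left-injective eq))
  centres-disjoint (inj₁ refl) (inj₂ eq) = ⊥-elim (left≢right _ _ eq)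
  centres-disjoint (inj₂ refl) (inj₁ eq) = ⊥-elim (left≢right _ _ (sym eq))
  centres-disjoint (inj₂ refl) (inj₂ eq) =
    inject≤-injective _ _ _ _ (punchIn-injective j _ _ (right-injective eq))
  bound-left : ∀ m → HasDisjointTrees G S m → m ≤ a
  bound-left m H with left-terminal-neighbours (swap KB) t H
  ... | g , g-injective , g∉S = injective-avoiding₂⇒≤ g-injective i≢i′
    (λ k eq → ∉⇒≢ (g∉S k) y∈S (cong left eq)) (λ k eq → ∉⇒≢ (g∉S k) z∈S (cong left eq))
  bound-right : ∀ m → HasDisjointTrees G S m → m ≤ b
  bound-right m H with left-terminal-neighbours KB (Triple-swap₁₂ t) H
  ... | g , g-injective , g∉S = injective-avoiding⇒≤ g-injective (λ k eq → ∉⇒≢ (g∉S k) x∈S (cong right eq))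

m⊓n≤m⊓1+n : ∀ m n → m ⊓ n ≤ m ⊓ suc n
m⊓n≤m⊓1+n m n = ⊓-monoʳ-≤ m (n≤1+n n)

m⊓n≤n⊓1+m : ∀ m n → m ⊓ n ≤ n ⊓ suc m
m⊓n≤n⊓1+m m n = ⊓-glb (m⊓n≤n m n) (≤-trans (m⊓n≤m m n) (n≤1+n m))

τ-triple-≥-⊓ : ∀ {n} {G : Graph n} {a b} → CompleteBipartite G (suc (suc a)) (suc (suc b)) →
  ∀ {S x y z} → Triple S x y z → ∃[ s ] IsTau G S s × a ⊓ b ≤ s
τ-triple-≥-⊓ {a = a} {b} KB {x = x} {y} {z} t with side x | side y | side z
  where open CompleteBipartite KB
... | inj₁ (_ , refl) | inj₁ (_ , refl) | inj₁ (_ , refl) = _ , τ-same-side KB t , ≤-trans (m⊓n≤n a b) (m≤n+m b 2)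
... | inj₂ (_ , refl) | inj₂ (_ , refl) | inj₂ (_ , refl) = _ , τ-same-side (swap KB) t , ≤-trans (m⊓n≤m a b) (m≤n+m a 2)
... | inj₂ (_ , refl) | inj₁ (_ , refl) | inj₁ (_ , refl) = _ , τ-two-sides KB t , m⊓n≤m⊓1+n a b
... | inj₁ (_ , refl) | inj₂ (_ , refl) | inj₁ (_ , refl) = _ , τ-two-sides KB (Triple-swap₁₂ t) , m⊓n≤m⊓1+n a b
... | inj₁ (_ , refl) | inj₁ (_ , refl) | inj₂ (_ , refl) = _ , τ-two-sides KB (Triple-rotate t) , m⊓n≤m⊓1+n a b
... | inj₁ (_ , refl) | inj₂ (_ , refl) | inj₂ (_ , refl) = _ , τ-two-sides (swap KB) t , m⊓n≤n⊓1+m a b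
... | inj₂ (_ , refl) | inj₁ (_ , refl) | inj₂ (_ , refl) = _ , τ-two-sides (swap KB) (Triple-swap₁₂ t) , m⊓n≤n⊓1+m a b
... | inj₂ (_ , refl) | inj₂ (_ , refl) | inj₁ (_ , refl) = _ , τ-two-sides (swap KB) (Triple-rotate t) , m⊓n≤n⊓1+m a b

two-left-one-right : ∀ a b → Subset (suc (suc a) + suc b)
two-left-one-right a b = inside ∷ inside ∷ ⁅ a ↑ʳ zero ⁆

∣two-left-one-right∣≡3 : ∀ a b → ∣ two-left-one-right a b ∣ ≡ 3
∣two-left-one-right∣≡3 a b = cong (λ k → suc (suc k)) (∣⁅x⁆∣≡1 (a ↑ʳ zero))

two-left-one-right-triple : ∀ a b →
  let open CompleteBipartite (K-complete-bipartite (suc (suc a)) (suc b)) in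
  Triple (two-left-one-right a b) (right zero) (left zero) (left (suc zero))
two-left-one-right-triple a b = record
  { x≢y = λ () ; x≢z = λ () ; y≢z = λ ()
  ; x∈S = there (there (x∈⁅x⁆ (a ↑ʳ zero))) ; y∈S = here ; z∈S = there here
  ; ∈S⇒ = members }
  where
  members : ∀ {v} → v ∈ two-left-one-right a b →
            v ≡ suc (suc (a ↑ʳ zero)) ⊎ v ≡ zero ⊎ v ≡ suc zero
  members {zero}          _                   = inj₂ (inj₁ refl)
  members {suc zero}      _                   = inj₂ (inj₂ refl)
  members {suc (suc v)}   (there (there v∈)) = inj₁ (cong (λ w → suc (suc w)) (x∈⁅y⁆⇒x≡y _ v∈))

corollary4p1 : (a b : ℕ) → 2 ≤ a → a ≤ b → IsTauK 3 (K a b) (a ∸ 2)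
corollary4p1 (suc (suc a)) (suc (suc b)) (s≤s (s≤s z≤n)) (s≤s (s≤s a≤b)) = lower , attained
  where
  KB : CompleteBipartite (K _ _) (suc (suc a)) (suc (suc b))
  KB = K-complete-bipartite (suc (suc a)) (suc (suc b))
  a⊓b≡a : a ⊓ b ≡ a
  a⊓b≡a = m≤n⇒m⊓n≡m a≤b
  lower : ∀ S → ∣ S ∣ ≡ 3 → ∃[ s ] IsTau (K _ _) S s × a ≤ s
  lower S ∣S∣≡3 with triple-of-∣S∣≡3 ∣S∣≡3
  ... | _ , _ , _ , t with τ-triple-≥-⊓ KB t
  ...   | s , τ≡s , a⊓b≤s = s , τ≡s , subst (_≤ s) a⊓b≡a a⊓b≤s
  attained : ∃[ S ] ∣ S ∣ ≡ 3 × IsTau (K _ _) S a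
  attained = two-left-one-right a (suc b) , ∣two-left-one-right∣≡3 a (suc b) ,
    subst (IsTau (K _ _) _) (m≤n⇒m⊓n≡m (m≤n⇒m≤1+n a≤b)) (τ-two-sides KB (two-left-one-right-triple a (suc b)))
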